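{- Let $H_1$ and $H_2$ be vertex-disjoint graphs, and for each $i\in\{1,2\}$ let $x_i$ be a non-isolated vertex of $H_i$. Let $G$ be the graph obtained from $H_1$ and $H_2$ by identifying $x_1$ and $x_2$ into a single vertex $x$. Then $G$ is weak bicritical if and only if for some $i\in\{1,2\}$: (1) $H_i$ is critical, (2) $H_{3-i}$ is weak bicritical, and (3) $x_{3-i}$ is a critical vertex of $H_{3-i}$. Furthermore, if $G$ is weak bicritical, then $\gamma(G)=\gamma(H_1)+\gamma(H_2)-1$.
   Context: All graphs are finite, simple and undirected. $\gamma(G)$ denotes the domination number of $G$ (minimum size of a set $S\subseteq V(G)$ such that every vertex is in $S$ or adjacent to a vertex of $S$). Define $V^{0}(G)=\{v:\gamma(G-v)=\gamma(G)\}$, $V^{+}(G)=\{v:\gamma(G-v)>\gamma(G)\}$, $V^{ - }(G)=\{v:\gamma(G-v)<\gamma(G)\}$. A vertex in $V^{ - }(G)$ is critical; $G$ is critical if every vertex is critical. $G$ is weak bicritical if $V^{+}(G)=\emptyset$ and $G-v$ is critical for every $v\in V^{0}(G)$. -}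

module Defs where

open import Data.Nat using (ℕ; zero; suc; _+_; _<_; _⊔_; _⊓_)
open import Data.Bool using (Bool; true; false; _∧_; _∨_; if_then_else_)
open import Data.Fin using (Fin; zero; suc; punchIn; splitAt; _≟_)
open import Data.Fin.Subset using (Subset; ∣_∣)
open import Data.Vec using (Vec; []; _∷_; lookup)
open import Data.List using (List; []; _∷_; map; foldr; _++_; filter; allFin)
open import Data.Sum using (_⊎_; inj₁; inj₂)
open import Data.Product using (∃; _×_)
open import Data.Unit using (⊤)
open import Relation.Nullary using (¬_; does)
open import Relation.Binary.PropositionalEquality using (_≡_; refl)

record Graph (n : ℕ) : Set where
  field
    adj    : Fin n → Fin n → Bool
    sym    : ∀ u v → adj u v ≡ adj v u
    irrefl : ∀ v → adj v v ≡ false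
open Graph public

_─_ : ∀ {m} → Graph (suc m) → Fin (suc m) → Graph m
adj    (G ─ v) i j = adj G (punchIn v i) (punchIn v j)
sym    (G ─ v) i j = sym G (punchIn v i) (punchIn v j)
irrefl (G ─ v) i   = irrefl G (punchIn v i)

anyFin : ∀ {n} → (Fin n → Bool) → Bool
anyFin f = foldr (λ i b → f i ∨ b) false (allFin _)

allFin? : ∀ {n} → (Fin n → Bool) → Bool
allFin? f = foldr (λ i b → f i ∧ b) true (allFin _)

isDominating : ∀ {n} → Graph n → Subset n → Bool
isDominating G S =
  allFin? (λ v → lookup S v ∨ anyFin (λ u → lookup S u ∧ adj G u v))

allSubsets : (n : ℕ) → List (Subset n)
allSubsets zero    = [] ∷ []
allSubsets (suc n) = map (true ∷_) (allSubsets n) ++ map (false ∷_) (allSubsets n)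

-- Domination number: minimum size of a dominating set
-- (the full vertex set is dominating, so n is a valid upper bound).
γ : ∀ {n} → Graph n → ℕ
γ {n} G = foldr _⊓_ n (map ∣_∣ (filter (λ S → isDominating G S ≟b true) (allSubsets n)))
  where
  open import Data.Bool.Properties using () renaming (_≟_ to _≟b_)

InV⁰ : ∀ {m} → Graph (suc m) → Fin (suc m) → Set
InV⁰ G v = γ (G ─ v) ≡ γ G

InV⁺ : ∀ {m} → Graph (suc m) → Fin (suc m) → Set
InV⁺ G v = γ G < γ (G ─ v)

InV⁻ : ∀ {m} → Graph (suc m) → Fin (suc m) → Set
InV⁻ G v = γ (G ─ v) < γ G

Critical : ∀ {n} → Graph n → Set
Critical {zero}  G = ⊤
Critical {suc m} G = ∀ v → InV⁻ G v

WeakBicritical : ∀ {n} → Graph n → Set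
WeakBicritical {zero}  G = ⊤
WeakBicritical {suc m} G = (∀ v → ¬ InV⁺ G v) × (∀ v → InV⁰ G v → Critical (G ─ v))

NonIsolated : ∀ {n} → Graph n → Fin n → Set
NonIsolated G x = ∃ λ y → adj G x y ≡ true

-- Vertices of the result: Fin (suc a + b);
-- the first (suc a) are the vertices of H₁ (x₁ plays the role of x),
-- the remaining b are the vertices of H₂ other than x₂ (relabelled via punchIn x₂).
module Glue {a b : ℕ} (H₁ : Graph (suc a)) (H₂ : Graph (suc b))
            (x₁ : Fin (suc a)) (x₂ : Fin (suc b)) where

  origin : Fin (suc a + b) → Fin (suc a) ⊎ Fin (suc b)
  origin i with splitAt (suc a) i
  ... | inj₁ p = inj₁ p
  ... | inj₂ q = inj₂ (punchIn x₂ q)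

  cross : Fin (suc a) → Fin (suc b) → Bool
  cross p q = if does (p ≟ x₁) then adj H₂ x₂ q else false

  adjO : Fin (suc a) ⊎ Fin (suc b) → Fin (suc a) ⊎ Fin (suc b) → Bool
  adjO (inj₁ p) (inj₁ p') = adj H₁ p p'
  adjO (inj₂ q) (inj₂ q') = adj H₂ q q'
  adjO (inj₁ p) (inj₂ q)  = cross p q
  adjO (inj₂ q) (inj₁ p)  = cross p q

  adjO-sym : ∀ u v → adjO u v ≡ adjO v u
  adjO-sym (inj₁ p) (inj₁ p') = sym H₁ p p'
  adjO-sym (inj₂ q) (inj₂ q') = sym H₂ q q'
  adjO-sym (inj₁ p) (inj₂ q)  = refl
  adjO-sym (inj₂ q) (inj₁ p)  = refl

  adjO-irr : ∀ u → adjO u u ≡ false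
  adjO-irr (inj₁ p) = irrefl H₁ p
  adjO-irr (inj₂ q) = irrefl H₂ q

  glued : Graph (suc a + b)
  adj    glued i j = adjO (origin i) (origin j)
  sym    glued i j = adjO-sym (origin i) (origin j)
  irrefl glued i   = adjO-irr (origin i)

glue : ∀ {a b} → Graph (suc a) → Graph (suc b) → Fin (suc a) → Fin (suc b) → Graph (suc a + b)
glue H₁ H₂ x₁ x₂ = Glue.glued H₁ H₂ x₁ x₂

module Submission where

-- Every domination number in the statement is that of an induced subgraph of G.
-- So we work inside a single graph with vertex sets A (Boolean predicates) and
-- the relative domination number Γ(A) = γ(G[A]), used only through two facts:
-- every dominating set of G[A] bounds it, and some dominating set attains it.
-- Embeddings of a graph K onto G[A] transfer γ, criticality and weak
-- bicriticality between K and A.  Within one graph, elementary set surgery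
-- gives: Γ is subadditive over covers, Γ(A) ≤ Γ(A − v) + 1, Γ is additive over
-- edgeless splits, and if A is glued from B and C at x then
--   Γ(A) ≤ Γ(B) + Γ(C − x)   and   Γ(B) + Γ(C) ≤ Γ(A) + 1.
-- From these inequalities alone the module Gluing proves both directions of the
-- theorem for arbitrary glued vertex sets; GluedGraph exhibits the two copies of
-- H₁ and H₂ in G as such a gluing, and theorem2p1 transfers the result back.

open import Defs hiding (sym)
open import Data.Nat using (ℕ; zero; suc; _+_; _∸_; _≤_; _<_; _<?_; _⊓_; z≤n; s≤s)
open import Data.Nat.Properties hiding (_≟_)
open import Data.Nat.Solver using (module +-*-Solver)
open import Algebra.Properties.CommutativeSemigroup +-commutativeSemigroup using (interchange)
open import Data.Bool using (Bool; true; false; _∧_; _∨_; not)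
open import Data.Bool.Properties using (∨-zeroʳ; ∧-identityʳ) renaming (_≟_ to _≟ᵇ_)
open import Data.Fin using (Fin; zero; suc; _↑ˡ_; _↑ʳ_; splitAt; punchIn; punchOut)
open import Data.Fin.Properties using (_≟_; all?; ¬∀⟶∃¬; punchIn-injective; punchInᵢ≢i; punchIn-punchOut;
  splitAt-↑ˡ; splitAt-↑ʳ; splitAt⁻¹-↑ˡ; splitAt⁻¹-↑ʳ; ↑ˡ-injective; ↑ʳ-injective)
import Data.Fin.Properties as Fin
open import Data.Fin.Subset using (Subset; ∣_∣)
open import Data.Fin.Subset.Properties using (∣p∣≤n)
open import Data.Vec using (_∷_; []; lookup; tabulate)
open import Data.Vec.Properties using (lookup∘tabulate)
open import Data.List using (List; _∷_; []; map; foldr; filter; allFin)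
open import Data.List.Properties using (filter-≐)
open import Data.List.Membership.Propositional using () renaming (_∈_ to _∈ˡ_)
open import Data.List.Membership.Propositional.Properties
  using (∈-map⁺; ∈-map⁻; ∈-++⁺ˡ; ∈-++⁺ʳ; ∈-filter⁺; ∈-filter⁻; ∈-allFin)
open import Data.List.Relation.Unary.Any using (here; there)
open import Data.Sum using (_⊎_; inj₁; inj₂; swap)
open import Data.Product using (∃; _×_; _,_; proj₁; proj₂)
open import Data.Empty using (⊥; ⊥-elim)
open import Data.Unit using (tt)
open import Function using (_∘_)
open import Function.Bundles using (_⇔_; mk⇔; module Equivalence)
open import Relation.Binary.PropositionalEquality
open import Relation.Binary.Definitions using (Tri; tri<; tri≈; tri>)
open import Relation.Nullary using (¬_; yes; no; does; Dec)
open import Relation.Nullary.Decidable using (dec-true; dec-false; toSum; _→-dec_)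

∧-true : ∀ {a b} → a ∧ b ≡ true → a ≡ true × b ≡ true
∧-true {true} {true} refl = refl , refl

∨-true : ∀ {a b} → a ∨ b ≡ true → a ≡ true ⊎ b ≡ true
∨-true {true}  _ = inj₁ refl
∨-true {false} p = inj₂ p

∨-trueˡ : ∀ {a} b → a ≡ true → a ∨ b ≡ true
∨-trueˡ b refl = refl

∨-trueʳ : ∀ a {b} → b ≡ true → a ∨ b ≡ true
∨-trueʳ true  _ = refl
∨-trueʳ false p = p

contradictory : ∀ {b} → b ≡ true → b ≡ false → ⊥
contradictory refl ()

implies-sound : ∀ a b → not a ∨ b ≡ true → a ≡ true → b ≡ true
implies-sound true b p refl = p

implies-complete : ∀ a b → (a ≡ true → b ≡ true) → not a ∨ b ≡ true
implies-complete true  b h = h refl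
implies-complete false b h = refl

allFin?-sound : ∀ {n} (f : Fin n → Bool) → allFin? f ≡ true → ∀ i → f i ≡ true
allFin?-sound f p i = go (allFin _) p (∈-allFin i)
  where
  go : ∀ xs → foldr (λ j b → f j ∧ b) true xs ≡ true → i ∈ˡ xs → f i ≡ true
  go (x ∷ xs) p (here refl) = proj₁ (∧-true {f x} p)
  go (x ∷ xs) p (there i∈) = go xs (proj₂ (∧-true {f x} p)) i∈

allFin?-complete : ∀ {n} (f : Fin n → Bool) → (∀ i → f i ≡ true) → allFin? f ≡ true
allFin?-complete f h = go (allFin _)
  where
  go : ∀ xs → foldr (λ j b → f j ∧ b) true xs ≡ true
  go []       = refl
  go (x ∷ xs) rewrite h x = go xs

anyFin-sound : ∀ {n} (f : Fin n → Bool) → anyFin f ≡ true → ∃ λ i → f i ≡ true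
anyFin-sound f = go (allFin _)
  where
  go : ∀ xs → foldr (λ j b → f j ∨ b) false xs ≡ true → ∃ λ i → f i ≡ true
  go (x ∷ xs) p with ∨-true {f x} p
  ... | inj₁ fx = x , fx
  ... | inj₂ q  = go xs q

anyFin-complete : ∀ {n} (f : Fin n → Bool) i → f i ≡ true → anyFin f ≡ true
anyFin-complete f i fi = go (allFin _) (∈-allFin i)
  where
  go : ∀ xs → i ∈ˡ xs → foldr (λ j b → f j ∨ b) false xs ≡ true
  go (x ∷ xs) (here refl) = ∨-trueˡ _ fi
  go (x ∷ xs) (there i∈)  = ∨-trueʳ (f x) (go xs i∈)

VSet : ℕ → Set
VSet n = Fin n → Bool

infix 4 _∈_ _⊆_
infixl 6 _∖_
infixr 7 _∪_ _∩_

_∈_ : ∀ {n} → Fin n → VSet n → Set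
v ∈ A = A v ≡ true

_∈?_ : ∀ {n} (v : Fin n) (A : VSet n) → Dec (v ∈ A)
v ∈? A = A v ≟ᵇ true

_⊆_ : ∀ {n} → VSet n → VSet n → Set
A ⊆ B = ∀ v → v ∈ A → v ∈ B

full ∅ : ∀ {n} → VSet n
full _ = true
∅    _ = false

⁅_⁆ : ∀ {n} → Fin n → VSet n
⁅ x ⁆ v = does (v ≟ x)

_∪_ _∩_ : ∀ {n} → VSet n → VSet n → VSet n
(A ∪ B) v = A v ∨ B v
(A ∩ B) v = A v ∧ B v

-- Deleting one vertex; the test comes first so that deleting 'zero' or
-- 'suc w' computes on the head and tail of a set.
_∖_ : ∀ {n} → VSet n → Fin n → VSet n
(A ∖ w) v = not (does (v ≟ w)) ∧ A v

∩-⊆ˡ : ∀ {n} (A B : VSet n) → A ∩ B ⊆ A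
∩-⊆ˡ A B v p = proj₁ (∧-true {A v} p)

∩-⊆ʳ : ∀ {n} (A B : VSet n) → A ∩ B ⊆ B
∩-⊆ʳ A B v p = proj₂ (∧-true {A v} p)

∈-⁅⁆ : ∀ {n} (x : Fin n) → x ∈ ⁅ x ⁆
∈-⁅⁆ x = dec-true (x ≟ x) refl

∈-⁅⁆⁻ : ∀ {n} {v x : Fin n} → v ∈ ⁅ x ⁆ → v ≡ x
∈-⁅⁆⁻ {v = v} {x} p with v ≟ x
∈-⁅⁆⁻ p  | yes v≡x = v≡x
∈-⁅⁆⁻ () | no _

∈-∖⁺ : ∀ {n} (A : VSet n) v w → v ∈ A → ¬ v ≡ w → v ∈ A ∖ w
∈-∖⁺ A v w v∈A v≢w rewrite dec-false (v ≟ w) v≢w = v∈A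

∖-⊆ : ∀ {n} (A : VSet n) w → A ∖ w ⊆ A
∖-⊆ A w v p = proj₂ (∧-true {not (does (v ≟ w))} p)

∈-∖-≢ : ∀ {n} (A : VSet n) v w → v ∈ A ∖ w → ¬ v ≡ w
∈-∖-≢ A v w p refl with v ≟ v
∈-∖-≢ A v w () refl | yes _
... | no v≢v = v≢v refl

indicator : Bool → ℕ
indicator true  = 1
indicator false = 0

size : ∀ {n} → VSet n → ℕ
size {zero}  A = 0
size {suc n} A = indicator (A zero) + size (A ∘ suc)

size-∅ : ∀ {n} → size (∅ {n}) ≡ 0
size-∅ {zero}  = refl
size-∅ {suc n} = size-∅ {n}

size-⁅⁆ : ∀ {n} (x : Fin n) → size ⁅ x ⁆ ≡ 1
size-⁅⁆ {suc n} zero    = cong suc (size-∅ {n})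
size-⁅⁆ {suc n} (suc x) = size-⁅⁆ x

size-∖ : ∀ {n} (A : VSet n) w → w ∈ A → size A ≡ suc (size (A ∖ w))
size-∖ {suc n} A zero    w∈A rewrite w∈A = refl
size-∖ {suc n} A (suc w) w∈A =
  trans (cong (indicator (A zero) +_) (size-∖ (A ∘ suc) w w∈A)) (+-suc _ _)

size-∪∩ : ∀ {n} (A B : VSet n) → size A + size B ≡ size (A ∪ B) + size (A ∩ B)
size-∪∩ {zero}  A B = refl
size-∪∩ {suc n} A B = begin
  (a + size (A ∘ suc)) + (b + size (B ∘ suc))
    ≡⟨ interchange a _ b _ ⟩
  (a + b) + (size (A ∘ suc) + size (B ∘ suc))
    ≡⟨ cong₂ _+_ (pointwise (A zero) (B zero)) (size-∪∩ (A ∘ suc) (B ∘ suc)) ⟩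
  (u + i) + (size ((A ∪ B) ∘ suc) + size ((A ∩ B) ∘ suc))
    ≡⟨ interchange u i _ _ ⟩
  (u + size ((A ∪ B) ∘ suc)) + (i + size ((A ∩ B) ∘ suc)) ∎
  where
  open ≡-Reasoning
  a b u i : ℕ
  a = indicator (A zero)
  b = indicator (B zero)
  u = indicator (A zero ∨ B zero)
  i = indicator (A zero ∧ B zero)
  pointwise : ∀ p q → indicator p + indicator q ≡ indicator (p ∨ q) + indicator (p ∧ q)
  pointwise true  true  = refl
  pointwise true  false = refl
  pointwise false true  = refl
  pointwise false false = refl

size-≤ : ∀ {n m} (A : VSet n) (B : VSet m) (R : Fin n → Fin m → Set) →
         (∀ v → v ∈ A → ∃ λ i → i ∈ B × R v i) →
         (∀ {u v i} → R u i → R v i → u ≡ v) →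
         size A ≤ size B
size-≤ {zero}  A B R into unique = z≤n
size-≤ {suc n} A B R into unique with A zero in A₀
... | false = size-≤ (A ∘ suc) B (R ∘ suc) (into ∘ suc) (λ r r′ → Fin.suc-injective (unique r r′))
... | true with into zero A₀
...   | i , i∈B , R₀i =
  ≤-trans (s≤s (size-≤ (A ∘ suc) (B ∖ i) (R ∘ suc) into′ (λ r r′ → Fin.suc-injective (unique r r′))))
          (≤-reflexive (sym (size-∖ B i i∈B)))
  where
  into′ : ∀ v → v ∈ A ∘ suc → ∃ λ j → j ∈ B ∖ i × R (suc v) j
  into′ v p with into (suc v) p
  ... | j , j∈B , r = j , ∈-∖⁺ B j i j∈B (λ { refl → Fin.0≢1+n (unique R₀i r) }) , r

size-mono : ∀ {n} {A B : VSet n} → A ⊆ B → size A ≤ size B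
size-mono {A = A} {B} A⊆B = size-≤ A B _≡_ (λ v v∈A → v , A⊆B v v∈A , refl) (λ r r′ → trans r (sym r′))

size-∪ : ∀ {n} (A B : VSet n) → size (A ∪ B) ≤ size A + size B
size-∪ A B = ≤-trans (m≤m+n _ _) (≤-reflexive (sym (size-∪∩ A B)))

size-overlap : ∀ {n} {P Q S T : VSet n} → P ⊆ S → Q ⊆ S → P ∩ Q ⊆ T → size P + size Q ≤ size S + size T
size-overlap {P = P} {Q} P⊆S Q⊆S P∩Q⊆T =
  ≤-trans (≤-reflexive (size-∪∩ P Q)) (+-mono-≤ (size-mono P∪Q⊆S) (size-mono P∩Q⊆T))
  where
  P∪Q⊆S : P ∪ Q ⊆ _
  P∪Q⊆S v p with ∨-true {P v} p
  ... | inj₁ v∈P = P⊆S v v∈P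
  ... | inj₂ v∈Q = Q⊆S v v∈Q

size-∩∩ : ∀ {n} (S B C T : VSet n) → (∀ v → v ∈ B → v ∈ C → v ∈ T) →
          size (S ∩ B) + size (S ∩ C) ≤ size S + size T
size-∩∩ S B C T B∩C⊆T = size-overlap (∩-⊆ˡ S B) (∩-⊆ˡ S C)
  (λ v p → B∩C⊆T v (∩-⊆ʳ S B v (∩-⊆ˡ (S ∩ B) (S ∩ C) v p))
                     (∩-⊆ʳ S C v (∩-⊆ʳ (S ∩ B) (S ∩ C) v p)))

size-∩∩-disjoint : ∀ {n} (S B C : VSet n) → (∀ v → v ∈ B → v ∈ C → ⊥) →
                   size (S ∩ B) + size (S ∩ C) ≤ size S
size-∩∩-disjoint {n} S B C disjoint =
  subst (size (S ∩ B) + size (S ∩ C) ≤_) (trans (cong (size S +_) (size-∅ {n})) (+-identityʳ _))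
    (size-∩∩ S B C ∅ (λ v v∈B v∈C → ⊥-elim (disjoint v v∈B v∈C)))

minSize : (n : ℕ) → (Subset n → Bool) → ℕ
minSize n P = foldr _⊓_ n (map ∣_∣ (filter (λ S → P S ≟ᵇ true) (allSubsets n)))

allSubsets-complete : ∀ {n} (S : Subset n) → S ∈ˡ allSubsets n
allSubsets-complete []                = here refl
allSubsets-complete {suc n} (true ∷ S)  = ∈-++⁺ˡ (∈-map⁺ (true ∷_) (allSubsets-complete S))
allSubsets-complete {suc n} (false ∷ S) =
  ∈-++⁺ʳ (map (true ∷_) (allSubsets n)) (∈-map⁺ (false ∷_) (allSubsets-complete S))

foldr-⊓-≤ : ∀ {d x} {xs : List ℕ} → x ∈ˡ xs → foldr _⊓_ d xs ≤ x
foldr-⊓-≤ {xs = y ∷ xs} (here refl) = m⊓n≤m y _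
foldr-⊓-≤ {xs = y ∷ xs} (there x∈)  = ≤-trans (m⊓n≤n y _) (foldr-⊓-≤ x∈)

foldr-⊓-sel : ∀ d (xs : List ℕ) → foldr _⊓_ d xs ≡ d ⊎ foldr _⊓_ d xs ∈ˡ xs
foldr-⊓-sel d []       = inj₁ refl
foldr-⊓-sel d (y ∷ xs) with ⊓-sel y (foldr _⊓_ d xs)
... | inj₁ e = inj₂ (here e)
... | inj₂ e with foldr-⊓-sel d xs
...   | inj₁ e′ = inj₁ (trans e e′)
...   | inj₂ m  = inj₂ (there (subst (_∈ˡ xs) (sym e) m))

minSize-≤ : ∀ {n} (P : Subset n → Bool) (S : Subset n) → P S ≡ true → minSize n P ≤ ∣ S ∣
minSize-≤ {n} P S PS =
  foldr-⊓-≤ (∈-map⁺ ∣_∣ (∈-filter⁺ (λ S → P S ≟ᵇ true) (allSubsets-complete S) PS))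

minSize-attained : ∀ {n} (P : Subset n → Bool) (S₀ : Subset n) → P S₀ ≡ true →
                   ∃ λ S → P S ≡ true × ∣ S ∣ ≡ minSize n P
minSize-attained {n} P S₀ PS₀ with foldr-⊓-sel n (map ∣_∣ (filter (λ S → P S ≟ᵇ true) (allSubsets n)))
... | inj₁ min≡n = S₀ , PS₀ , ≤-antisym (subst (∣ S₀ ∣ ≤_) (sym min≡n) (∣p∣≤n S₀)) (minSize-≤ P S₀ PS₀)
... | inj₂ min∈ with ∈-map⁻ ∣_∣ min∈
...   | S , S∈ , e = S , proj₂ (∈-filter⁻ (λ S → P S ≟ᵇ true) {xs = allSubsets n} S∈) , sym e

minSize-cong : ∀ {n} {P Q : Subset n → Bool} → (∀ S → P S ≡ Q S) → minSize n P ≡ minSize n Q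
minSize-cong {n} P≗Q = cong (foldr _⊓_ n ∘ map ∣_∣)
  (filter-≐ _ _ ((λ p → trans (sym (P≗Q _)) p) , (λ q → trans (P≗Q _) q)) (allSubsets n))

size-lookup : ∀ {n} (V : Subset n) → size (lookup V) ≡ ∣ V ∣
size-lookup []          = refl
size-lookup (true ∷ V)  = cong suc (size-lookup V)
size-lookup (false ∷ V) = size-lookup V

size-tabulate : ∀ {n} (S : VSet n) → ∣ tabulate S ∣ ≡ size S
size-tabulate {zero}  S = refl
size-tabulate {suc n} S with S zero
... | true  = cong suc (size-tabulate (S ∘ suc))
... | false = size-tabulate (S ∘ suc)

-- Domination relative to a vertex set: Γ G A is the domination number
-- of the induced subgraph G[A], computed inside G.

Dominates : ∀ {n} → Graph n → VSet n → VSet n → Set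
Dominates G S A = ∀ v → v ∈ A → v ∈ S ⊎ ∃ λ u → u ∈ S × adj G u v ≡ true

DomSetOf : ∀ {n} → Graph n → VSet n → VSet n → Set
DomSetOf G A S = S ⊆ A × Dominates G S A

Dominates-mono : ∀ {n} (G : Graph n) {S S′ A} → S ⊆ S′ → Dominates G S A → Dominates G S′ A
Dominates-mono G S⊆S′ dom v v∈A with dom v v∈A
... | inj₁ v∈S           = inj₁ (S⊆S′ v v∈S)
... | inj₂ (u , u∈S , a) = inj₂ (u , S⊆S′ u u∈S , a)

-- Boolean decision procedures; dominatedᵇ is the test used by isDominating in Defs.
dominatedᵇ : ∀ {n} → Graph n → Subset n → Fin n → Bool
dominatedᵇ G V v = lookup V v ∨ anyFin (λ u → lookup V u ∧ adj G u v)

domSetOfᵇ : ∀ {n} → Graph n → VSet n → Subset n → Bool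
domSetOfᵇ G A V = allFin? (λ v → not (A v) ∨ dominatedᵇ G V v) ∧ allFin? (λ v → not (lookup V v) ∨ A v)

-- Γ is kept opaque: beyond this block it is used only through Γ-≤, Γ-attained
-- and γ≡Γ-full.
opaque
  Γ : ∀ {n} → Graph n → VSet n → ℕ
  Γ {n} G A = minSize n (domSetOfᵇ G A)

dominatedᵇ-sound : ∀ {n} (G : Graph n) V v → dominatedᵇ G V v ≡ true →
                   v ∈ lookup V ⊎ ∃ λ u → u ∈ lookup V × adj G u v ≡ true
dominatedᵇ-sound G V v p with ∨-true {lookup V v} p
... | inj₁ v∈V = inj₁ v∈V
... | inj₂ q with anyFin-sound _ q
...   | u , r = inj₂ (u , ∧-true r)

dominatedᵇ-complete : ∀ {n} (G : Graph n) V v → v ∈ lookup V ⊎ (∃ λ u → u ∈ lookup V × adj G u v ≡ true) →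
                      dominatedᵇ G V v ≡ true
dominatedᵇ-complete G V v (inj₁ v∈V)           = ∨-trueˡ _ v∈V
dominatedᵇ-complete G V v (inj₂ (u , u∈V , a)) = ∨-trueʳ (lookup V v) (anyFin-complete _ u (cong₂ _∧_ u∈V a))

domSetOfᵇ-sound : ∀ {n} (G : Graph n) A V → domSetOfᵇ G A V ≡ true → DomSetOf G A (lookup V)
domSetOfᵇ-sound G A V p with ∧-true {allFin? (λ v → not (A v) ∨ dominatedᵇ G V v)} p
... | dom , sub =
  (λ v → implies-sound _ _ (allFin?-sound _ sub v)) ,
  (λ v v∈A → dominatedᵇ-sound G V v (implies-sound _ _ (allFin?-sound _ dom v) v∈A))

domSetOfᵇ-complete : ∀ {n} (G : Graph n) A V → DomSetOf G A (lookup V) → domSetOfᵇ G A V ≡ true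
domSetOfᵇ-complete G A V (sub , dom) = cong₂ _∧_
  (allFin?-complete _ (λ v → implies-complete _ _ (dominatedᵇ-complete G V v ∘ dom v)))
  (allFin?-complete _ (λ v → implies-complete _ _ (sub v)))

opaque
  unfolding Γ

  Γ-≤ : ∀ {n} (G : Graph n) A S → DomSetOf G A S → Γ G A ≤ size S
  Γ-≤ G A S (sub , dom) = ≤-trans
    (minSize-≤ (domSetOfᵇ G A) (tabulate S) (domSetOfᵇ-complete G A (tabulate S) (sub′ , dom′)))
    (≤-reflexive (size-tabulate S))
    where
    S⊆S′ : S ⊆ lookup (tabulate S)
    S⊆S′ v v∈S = trans (lookup∘tabulate S v) v∈S
    sub′ : lookup (tabulate S) ⊆ A
    sub′ v p = sub v (trans (sym (lookup∘tabulate S v)) p)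
    dom′ : Dominates G (lookup (tabulate S)) A
    dom′ = Dominates-mono G S⊆S′ dom

  Γ-attained : ∀ {n} (G : Graph n) A → ∃ λ S → DomSetOf G A S × size S ≡ Γ G A
  Γ-attained G A with minSize-attained (domSetOfᵇ G A) (tabulate A)
                        (domSetOfᵇ-complete G A (tabulate A) (A-dominates-itself))
    where
    A-dominates-itself : DomSetOf G A (lookup (tabulate A))
    A-dominates-itself = (λ v p → trans (sym (lookup∘tabulate A v)) p) ,
                         (λ v v∈A → inj₁ (trans (lookup∘tabulate A v) v∈A))
  ... | V , ok , |V| = lookup V , domSetOfᵇ-sound G A V ok , trans (size-lookup V) |V|

  γ≡Γ-full : ∀ {n} (G : Graph n) → γ G ≡ Γ G full
  γ≡Γ-full G = minSize-cong (λ V → sym (trans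
    (cong (isDominating G V ∧_) (allFin?-complete _ (λ v → ∨-zeroʳ (not (lookup V v))))) (∧-identityʳ _)))

image : ∀ {m n} → (Fin m → Fin n) → VSet m → VSet n
image f T v = anyFin (λ i → T i ∧ does (f i ≟ v))

∈-image⁺ : ∀ {m n} (f : Fin m → Fin n) (T : VSet m) i → i ∈ T → f i ∈ image f T
∈-image⁺ f T i i∈T = anyFin-complete _ i (cong₂ _∧_ i∈T (dec-true (f i ≟ f i) refl))

∈-image⁻ : ∀ {m n} (f : Fin m → Fin n) (T : VSet m) v → v ∈ image f T → ∃ λ i → i ∈ T × f i ≡ v
∈-image⁻ f T v p with anyFin-sound _ p
... | i , q with ∧-true {T i} q
...   | i∈T , fi≡v = i , i∈T , ∈-⁅⁆⁻ fi≡v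

size-image : ∀ {m n} (f : Fin m → Fin n) (T : VSet m) → size (image f T) ≤ size T
size-image f T = size-≤ (image f T) T (λ v i → f i ≡ v) (∈-image⁻ f T) (λ r r′ → trans (sym r) r′)

record Embedding {m n} (K : Graph m) (G : Graph n) (A : VSet n) : Set where
  field
    embed     : Fin m → Fin n
    injective : ∀ {i j} → embed i ≡ embed j → i ≡ j
    adjacency : ∀ i j → adj K i j ≡ adj G (embed i) (embed j)
    into      : ∀ i → embed i ∈ A
    onto      : ∀ v → v ∈ A → ∃ λ i → embed i ≡ v

module _ {m n} {K : Graph m} {G : Graph n} {A : VSet n} (E : Embedding K G A) where
  open Embedding E

  image-dominates : ∀ T → Dominates K T full → DomSetOf G A (image embed T)
  image-dominates T dom = sub , dom′
    where
    sub : image embed T ⊆ A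
    sub v p with ∈-image⁻ embed T v p
    ... | i , _ , refl = into i
    dom′ : Dominates G (image embed T) A
    dom′ v v∈A with onto v v∈A
    ... | i , refl with dom i refl
    ...   | inj₁ i∈T           = inj₁ (∈-image⁺ embed T i i∈T)
    ...   | inj₂ (j , j∈T , a) = inj₂ (embed j , ∈-image⁺ embed T j j∈T , trans (sym (adjacency j i)) a)

  preimage-dominates : ∀ S → DomSetOf G A S → Dominates K (S ∘ embed) full
  preimage-dominates S (sub , dom) i _ with dom (embed i) (into i)
  ... | inj₁ ei∈S           = inj₁ ei∈S
  ... | inj₂ (u , u∈S , a) with onto u (sub u u∈S)
  ...   | j , refl = inj₂ (j , u∈S , trans (adjacency j i) a)

  γ-embedding : γ K ≡ Γ G A
  γ-embedding = ≤-antisym γK≤ΓA ΓA≤γK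
    where
    ΓA≤γK : Γ G A ≤ γ K
    ΓA≤γK with Γ-attained K full
    ... | T , (_ , dom) , |T| = begin
      Γ G A               ≤⟨ Γ-≤ G A (image embed T) (image-dominates T dom) ⟩
      size (image embed T) ≤⟨ size-image embed T ⟩
      size T              ≡⟨ trans |T| (sym (γ≡Γ-full K)) ⟩
      γ K                 ∎
      where open ≤-Reasoning
    γK≤ΓA : γ K ≤ Γ G A
    γK≤ΓA with Γ-attained G A
    ... | S , domS , |S| = begin
      γ K            ≡⟨ γ≡Γ-full K ⟩
      Γ K full       ≤⟨ Γ-≤ K full (S ∘ embed) ((λ _ _ → refl) , preimage-dominates S domS) ⟩
      size (S ∘ embed) ≤⟨ size-≤ (S ∘ embed) S (λ i v → embed i ≡ v) (λ i p → embed i , p , refl)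
                            (λ r r′ → injective (trans r (sym r′))) ⟩
      size S         ≡⟨ |S| ⟩
      Γ G A          ∎
      where open ≤-Reasoning

delete : ∀ {m n} {K : Graph (suc m)} {G : Graph n} {A : VSet n} (E : Embedding K G A) (i : Fin (suc m)) →
         Embedding (K ─ i) G (A ∖ Embedding.embed E i)
delete {K = K} {G} {A} E i = record
  { embed     = embed ∘ punchIn i
  ; injective = punchIn-injective i _ _ ∘ injective
  ; adjacency = λ j k → adjacency (punchIn i j) (punchIn i k)
  ; into      = λ j → ∈-∖⁺ A _ _ (into (punchIn i j)) (punchInᵢ≢i i j ∘ injective)
  ; onto      = onto′ }
  where
  open Embedding E
  onto′ : ∀ v → v ∈ A ∖ embed i → ∃ λ j → embed (punchIn i j) ≡ v
  onto′ v p with onto v (∖-⊆ A (embed i) v p)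
  ... | j , refl = punchOut i≢j , cong embed (punchIn-punchOut i≢j)
    where
    i≢j : ¬ i ≡ j
    i≢j i≡j = ∈-∖-≢ A _ _ p (cong embed (sym i≡j))

CriticalIn : ∀ {n} → Graph n → VSet n → Set
CriticalIn G A = ∀ v → v ∈ A → Γ G (A ∖ v) < Γ G A

WeakBicriticalIn : ∀ {n} → Graph n → VSet n → Set
WeakBicriticalIn G A =
  (∀ v → v ∈ A → ¬ Γ G A < Γ G (A ∖ v)) × (∀ v → v ∈ A → Γ G (A ∖ v) ≡ Γ G A → CriticalIn G (A ∖ v))

γ-delete : ∀ {m n} {K : Graph (suc m)} {G : Graph n} {A : VSet n} (E : Embedding K G A) i →
           γ (K ─ i) ≡ Γ G (A ∖ Embedding.embed E i)
γ-delete E i = γ-embedding (delete E i)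

no-vertex : ∀ {n} {K : Graph 0} {G : Graph n} {A : VSet n} → Embedding K G A → ∀ v → ¬ v ∈ A
no-vertex E v v∈A with Embedding.onto E v v∈A
... | () , _

critical⇔ : ∀ {m n} {K : Graph m} {G : Graph n} {A : VSet n} → Embedding K G A → Critical K ⇔ CriticalIn G A
critical⇔ {zero}  E = mk⇔ (λ _ v v∈A → ⊥-elim (no-vertex E v v∈A)) (λ _ → tt)
critical⇔ {suc m} {K = K} {G} {A} E = mk⇔ forth back
  where
  open Embedding E
  forth : Critical K → CriticalIn G A
  forth crit v v∈A with onto v v∈A
  ... | i , refl = subst₂ _<_ (γ-delete E i) (γ-embedding E) (crit i)
  back : CriticalIn G A → Critical K
  back crit i = subst₂ _<_ (sym (γ-delete E i)) (sym (γ-embedding E)) (crit (embed i) (into i))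

weakBicritical⇔ : ∀ {m n} {K : Graph m} {G : Graph n} {A : VSet n} → Embedding K G A →
                  WeakBicritical K ⇔ WeakBicriticalIn G A
weakBicritical⇔ {zero}  E =
  mk⇔ (λ _ → (λ v v∈A → ⊥-elim (no-vertex E v v∈A)) , (λ v v∈A → ⊥-elim (no-vertex E v v∈A))) (λ _ → tt)
weakBicritical⇔ {suc m} {K = K} {G} {A} E = mk⇔ forth back
  where
  open Embedding E
  forth : WeakBicritical K → WeakBicriticalIn G A
  forth (no-V⁺ , V⁰-critical) = no-V⁺′ , V⁰-critical′
    where
    no-V⁺′ : ∀ v → v ∈ A → ¬ Γ G A < Γ G (A ∖ v)
    no-V⁺′ v v∈A with onto v v∈A
    ... | i , refl = no-V⁺ i ∘ subst₂ _<_ (sym (γ-embedding E)) (sym (γ-delete E i))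
    V⁰-critical′ : ∀ v → v ∈ A → Γ G (A ∖ v) ≡ Γ G A → CriticalIn G (A ∖ v)
    V⁰-critical′ v v∈A eq with onto v v∈A
    ... | i , refl = Equivalence.to (critical⇔ (delete E i))
                       (V⁰-critical i (trans (γ-delete E i) (trans eq (sym (γ-embedding E)))))
  back : WeakBicriticalIn G A → WeakBicritical K
  back (no-V⁺ , V⁰-critical) =
    (λ i → no-V⁺ (embed i) (into i) ∘ subst₂ _<_ (γ-embedding E) (γ-delete E i)) ,
    (λ i eq → Equivalence.from (critical⇔ (delete E i))
                (V⁰-critical (embed i) (into i) (trans (sym (γ-delete E i)) (trans eq (γ-embedding E)))))

identity : ∀ {n} (G : Graph n) → Embedding G G full
identity G = record
  { embed = λ i → i ; injective = λ e → e ; adjacency = λ _ _ → refl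
  ; into = λ _ → refl ; onto = λ v _ → v , refl }

critical-vertex⇔ : ∀ {m n} {K : Graph (suc m)} {G : Graph n} {A : VSet n} (E : Embedding K G A) i →
                   InV⁻ K i ⇔ Γ G (A ∖ Embedding.embed E i) < Γ G A
critical-vertex⇔ E i = mk⇔ (subst₂ _<_ (γ-delete E i) (γ-embedding E))
                          (subst₂ _<_ (sym (γ-delete E i)) (sym (γ-embedding E)))

module Inequalities {n} (G : Graph n) where

  γ[_] : VSet n → ℕ
  γ[ A ] = Γ G A

  -- Γ is subadditive: the union of dominating sets of B and C dominates B ∪ C.
  Γ-cover : ∀ A B C → B ⊆ A → C ⊆ A → (∀ v → v ∈ A → v ∈ B ⊎ v ∈ C) → γ[ A ] ≤ γ[ B ] + γ[ C ]
  Γ-cover A B C B⊆A C⊆A cover with Γ-attained G B | Γ-attained G C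
  ... | SB , (SB⊆B , SB-dom) , |SB| | SC , (SC⊆C , SC-dom) , |SC| = begin
    γ[ A ]              ≤⟨ Γ-≤ G A (SB ∪ SC) (sub , dom) ⟩
    size (SB ∪ SC)      ≤⟨ size-∪ SB SC ⟩
    size SB + size SC   ≡⟨ cong₂ _+_ |SB| |SC| ⟩
    γ[ B ] + γ[ C ]     ∎
    where
    open ≤-Reasoning
    sub : SB ∪ SC ⊆ A
    sub v p with ∨-true {SB v} p
    ... | inj₁ v∈SB = B⊆A v (SB⊆B v v∈SB)
    ... | inj₂ v∈SC = C⊆A v (SC⊆C v v∈SC)
    dom : Dominates G (SB ∪ SC) A
    dom v v∈A with cover v v∈A
    ... | inj₁ v∈B = Dominates-mono G (λ u → ∨-trueˡ (SC u)) SB-dom v v∈B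
    ... | inj₂ v∈C = Dominates-mono G (λ u → ∨-trueʳ (SB u)) SC-dom v v∈C

  -- If every vertex of A outside A′ ⊆ A lies in the closed neighbourhood of
  -- some x ∈ A, then adding x to a dominating set of A′ dominates A.
  Γ-star : ∀ A A′ x → x ∈ A → A′ ⊆ A → (∀ w → w ∈ A → ¬ w ∈ A′ → w ≡ x ⊎ adj G x w ≡ true) →
           γ[ A ] ≤ suc γ[ A′ ]
  Γ-star A A′ x x∈A A′⊆A near-x with Γ-attained G A′
  ... | S′ , (S′⊆A′ , S′-dom) , |S′| = begin
    γ[ A ]                  ≤⟨ Γ-≤ G A (S′ ∪ ⁅ x ⁆) (sub , dom) ⟩
    size (S′ ∪ ⁅ x ⁆)       ≤⟨ size-∪ S′ ⁅ x ⁆ ⟩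
    size S′ + size ⁅ x ⁆    ≡⟨ cong₂ _+_ |S′| (size-⁅⁆ x) ⟩
    γ[ A′ ] + 1             ≡⟨ +-comm _ 1 ⟩
    suc γ[ A′ ]             ∎
    where
    open ≤-Reasoning
    x∈S : x ∈ S′ ∪ ⁅ x ⁆
    x∈S = ∨-trueʳ (S′ x) (∈-⁅⁆ x)
    sub : S′ ∪ ⁅ x ⁆ ⊆ A
    sub v p with ∨-true {S′ v} p
    ... | inj₁ v∈S′ = A′⊆A v (S′⊆A′ v v∈S′)
    ... | inj₂ v≡x  = subst (_∈ A) (sym (∈-⁅⁆⁻ v≡x)) x∈A
    dom : Dominates G (S′ ∪ ⁅ x ⁆) A
    dom v v∈A with v ∈? A′
    ... | yes v∈A′ = Dominates-mono G (λ u → ∨-trueˡ _) S′-dom v v∈A′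
    ... | no  v∉A′ with near-x v v∈A v∉A′
    ...   | inj₁ refl = inj₁ x∈S
    ...   | inj₂ a    = inj₂ (x , x∈S , a)

  Γ-∖ : ∀ A x → x ∈ A → γ[ A ] ≤ suc γ[ A ∖ x ]
  Γ-∖ A x x∈A = Γ-star A (A ∖ x) x x∈A (∖-⊆ A x) near-x
    where
    near-x : ∀ w → w ∈ A → ¬ w ∈ A ∖ x → w ≡ x ⊎ adj G x w ≡ true
    near-x w w∈A w∉A∖x with toSum (w ≟ x)
    ... | inj₁ w≡x = inj₁ w≡x
    ... | inj₂ w≢x = ⊥-elim (w∉A∖x (∈-∖⁺ A w x w∈A w≢x))

  record Split (A B C : VSet n) : Set where
    field
      B⊆A      : B ⊆ A
      C⊆A      : C ⊆ A
      cover    : ∀ v → v ∈ A → v ∈ B ⊎ v ∈ C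
      disjoint : ∀ v → v ∈ B → v ∈ C → ⊥
      no-edge  : ∀ u w → u ∈ B → w ∈ C → adj G u w ≡ false

  Split-sym : ∀ {A B C} → Split A B C → Split A C B
  Split-sym s = record
    { B⊆A = C⊆A ; C⊆A = B⊆A ; cover = λ v → swap ∘ cover v
    ; disjoint = λ v c b → disjoint v b c
    ; no-edge  = λ u w u∈C w∈B → trans (Graph.sym G u w) (no-edge w u w∈B u∈C) }
    where open Split s

  Split-∖ : ∀ {A B C} u → Split A B C → u ∈ B → Split (A ∖ u) (B ∖ u) C
  Split-∖ {A} {B} {C} u s u∈B = record
    { B⊆A      = λ w p → ∈-∖⁺ A w u (B⊆A w (∖-⊆ B u w p)) (∈-∖-≢ B w u p)
    ; C⊆A      = λ w w∈C → ∈-∖⁺ A w u (C⊆A w w∈C) (λ { refl → disjoint w u∈B w∈C })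
    ; cover    = cover′
    ; disjoint = λ v p → disjoint v (∖-⊆ B u v p)
    ; no-edge  = λ v w p → no-edge v w (∖-⊆ B u v p) }
    where
    open Split s
    cover′ : ∀ w → w ∈ A ∖ u → w ∈ B ∖ u ⊎ w ∈ C
    cover′ w p with cover w (∖-⊆ A u w p)
    ... | inj₁ w∈B = inj₁ (∈-∖⁺ B w u w∈B (∈-∖-≢ A w u p))
    ... | inj₂ w∈C = inj₂ w∈C

  Split-restrict : ∀ {A B C S} → Split A B C → DomSetOf G A S → DomSetOf G B (S ∩ B)
  Split-restrict {A} {B} {C} {S} s (S⊆A , S-dom) = ∩-⊆ʳ S B , dom
    where
    open Split s
    dom : Dominates G (S ∩ B) B
    dom v v∈B with S-dom v (B⊆A v v∈B)
    ... | inj₁ v∈S = inj₁ (cong₂ _∧_ v∈S v∈B)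
    ... | inj₂ (u , u∈S , a) with cover u (S⊆A u u∈S)
    ...   | inj₁ u∈B = inj₂ (u , cong₂ _∧_ u∈S u∈B , a)
    ...   | inj₂ u∈C = ⊥-elim (contradictory a (trans (Graph.sym G u v) (no-edge v u v∈B u∈C)))

  Γ-split-≤ : ∀ {A B C} → Split A B C → γ[ A ] ≤ γ[ B ] + γ[ C ]
  Γ-split-≤ {A} {B} {C} s = Γ-cover A B C (Split.B⊆A s) (Split.C⊆A s) (Split.cover s)

  Γ-split-≥ : ∀ {A B C} → Split A B C → γ[ B ] + γ[ C ] ≤ γ[ A ]
  Γ-split-≥ {A} {B} {C} s with Γ-attained G A
  ... | S , S-dom , |S| = begin
    γ[ B ] + γ[ C ]              ≤⟨ +-mono-≤ (Γ-≤ G B _ (Split-restrict s S-dom))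
                                             (Γ-≤ G C _ (Split-restrict (Split-sym s) S-dom)) ⟩
    size (S ∩ B) + size (S ∩ C)  ≤⟨ size-∩∩-disjoint S B C (Split.disjoint s) ⟩
    size S                       ≡⟨ |S| ⟩
    γ[ A ]                       ∎
    where open ≤-Reasoning

  record Glued (A B C : VSet n) (x : Fin n) : Set where
    field
      B⊆A     : B ⊆ A
      C⊆A     : C ⊆ A
      cover   : ∀ v → v ∈ A → v ∈ B ⊎ v ∈ C
      x∈B     : x ∈ B
      x∈C     : x ∈ C
      meet    : ∀ v → v ∈ B → v ∈ C → v ≡ x
      no-edge : ∀ u w → u ∈ B → w ∈ C → ¬ u ≡ x → ¬ w ≡ x → adj G u w ≡ false

  Glued-sym : ∀ {A B C x} → Glued A B C x → Glued A C B x
  Glued-sym g = record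
    { B⊆A = C⊆A ; C⊆A = B⊆A ; cover = λ v → swap ∘ cover v ; x∈B = x∈C ; x∈C = x∈B
    ; meet    = λ v c b → meet v b c
    ; no-edge = λ u w u∈C w∈B u≢x w≢x → trans (Graph.sym G u w) (no-edge w u w∈B u∈C w≢x u≢x) }
    where open Glued g

  Glued-∖ : ∀ {A B C x} v → Glued A B C x → v ∈ B → ¬ v ≡ x → Glued (A ∖ v) (B ∖ v) C x
  Glued-∖ {A} {B} {C} {x} v g v∈B v≢x = record
    { B⊆A     = λ w p → ∈-∖⁺ A w v (B⊆A w (∖-⊆ B v w p)) (∈-∖-≢ B w v p)
    ; C⊆A     = λ w w∈C → ∈-∖⁺ A w v (C⊆A w w∈C) (λ { refl → v≢x (meet w v∈B w∈C) })
    ; cover   = cover′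
    ; x∈B     = ∈-∖⁺ B x v x∈B (v≢x ∘ sym)
    ; x∈C     = x∈C
    ; meet    = λ w p → meet w (∖-⊆ B v w p)
    ; no-edge = λ u w p → no-edge u w (∖-⊆ B v u p) }
    where
    open Glued g
    cover′ : ∀ w → w ∈ A ∖ v → w ∈ B ∖ v ⊎ w ∈ C
    cover′ w p with cover w (∖-⊆ A v w p)
    ... | inj₁ w∈B = inj₁ (∈-∖⁺ B w v w∈B (∈-∖-≢ A w v p))
    ... | inj₂ w∈C = inj₂ w∈C

  Glued-∖ʳ : ∀ {A B C x} v → Glued A B C x → v ∈ C → ¬ v ≡ x → Glued (A ∖ v) B (C ∖ v) x
  Glued-∖ʳ v g v∈C v≢x = Glued-sym (Glued-∖ v (Glued-sym g) v∈C v≢x)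

  Glued-split : ∀ {A B C x} → Glued A B C x → Split (A ∖ x) (B ∖ x) (C ∖ x)
  Glued-split {A} {B} {C} {x} g = record
    { B⊆A      = λ w p → ∈-∖⁺ A w x (B⊆A w (∖-⊆ B x w p)) (∈-∖-≢ B w x p)
    ; C⊆A      = λ w p → ∈-∖⁺ A w x (C⊆A w (∖-⊆ C x w p)) (∈-∖-≢ C w x p)
    ; cover    = cover′
    ; disjoint = λ v p q → ∈-∖-≢ B v x p (meet v (∖-⊆ B x v p) (∖-⊆ C x v q))
    ; no-edge  = λ u w p q → no-edge u w (∖-⊆ B x u p) (∖-⊆ C x w q) (∈-∖-≢ B u x p) (∈-∖-≢ C w x q) }
    where
    open Glued g
    cover′ : ∀ w → w ∈ A ∖ x → w ∈ B ∖ x ⊎ w ∈ C ∖ x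
    cover′ w p with cover w (∖-⊆ A x w p)
    ... | inj₁ w∈B = inj₁ (∈-∖⁺ B w x w∈B (∈-∖-≢ A w x p))
    ... | inj₂ w∈C = inj₂ (∈-∖⁺ C w x w∈C (∈-∖-≢ A w x p))

  Glued-cover : ∀ {A B C x} → Glued A B C x → ∀ w → w ∈ A → w ∈ B ⊎ w ∈ C ∖ x
  Glued-cover {A} {B} {C} {x} g w w∈A with Glued.cover g w w∈A | toSum (w ≟ x)
  ... | inj₁ w∈B | _         = inj₁ w∈B
  ... | inj₂ _   | inj₁ refl = inj₁ (Glued.x∈B g)
  ... | inj₂ w∈C | inj₂ w≢x  = inj₂ (∈-∖⁺ C w x w∈C w≢x)

  -- Upper bound: dominate B, and C − x separately.
  Γ-glued-≤ : ∀ {A B C x} → Glued A B C x → γ[ A ] ≤ γ[ B ] + γ[ C ∖ x ]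
  Γ-glued-≤ {A} {B} {C} {x} g =
    Γ-cover A B (C ∖ x) (Glued.B⊆A g) (λ w p → Glued.C⊆A g w (∖-⊆ C x w p)) (Glued-cover g)

  Glued-restrict : ∀ {A B C x S} → Glued A B C x → DomSetOf G A S →
                   (x ∈ S ⊎ ∃ λ u → u ∈ S × u ∈ B × adj G u x ≡ true) → DomSetOf G B (S ∩ B)
  Glued-restrict {A} {B} {C} {x} {S} g (S⊆A , S-dom) x-dominated = ∩-⊆ʳ S B , dom
    where
    open Glued g
    from-B : (x ∈ S ⊎ ∃ λ u → u ∈ S × u ∈ B × adj G u x ≡ true) →
             x ∈ S ∩ B ⊎ ∃ λ u → u ∈ S ∩ B × adj G u x ≡ true
    from-B (inj₁ x∈S)                 = inj₁ (cong₂ _∧_ x∈S x∈B)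
    from-B (inj₂ (u , u∈S , u∈B , a)) = inj₂ (u , cong₂ _∧_ u∈S u∈B , a)
    dom : Dominates G (S ∩ B) B
    dom v v∈B with S-dom v (B⊆A v v∈B)
    ... | inj₁ v∈S = inj₁ (cong₂ _∧_ v∈S v∈B)
    ... | inj₂ (u , u∈S , a) with u ∈? B
    ...   | yes u∈B = inj₂ (u , cong₂ _∧_ u∈S u∈B , a)
    ...   | no u∉B with cover u (S⊆A u u∈S) | toSum (v ≟ x)
    ...     | inj₁ u∈B | _         = ⊥-elim (u∉B u∈B)
    ...     | inj₂ _   | inj₁ refl = from-B x-dominated
    ...     | inj₂ u∈C | inj₂ v≢x  =
      ⊥-elim (contradictory a (trans (Graph.sym G u v) (no-edge v u v∈B u∈C v≢x (λ { refl → u∉B x∈B }))))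

  private
    Γ-glued-≥-via : ∀ {A B C x S u} → Glued A B C x → DomSetOf G A S → size S ≡ γ[ A ] →
                    ¬ x ∈ S → u ∈ S → u ∈ B → adj G u x ≡ true → γ[ B ] + γ[ C ] ≤ suc γ[ A ]
    Γ-glued-≥-via {A} {B} {C} {x} {S} {u} g S-dom@(S⊆A , S-dom′) |S| x∉S u∈S u∈B a = begin
      γ[ B ] + γ[ C ]                      ≤⟨ +-monoʳ-≤ γ[ B ] (Γ-∖ C x x∈C) ⟩
      γ[ B ] + suc γ[ C ∖ x ]              ≡⟨ +-suc _ _ ⟩
      suc (γ[ B ] + γ[ C ∖ x ])            ≤⟨ s≤s (+-mono-≤ (Γ-≤ G B _ domB) (Γ-≤ G (C ∖ x) _ domC)) ⟩
      suc (size (S ∩ B) + size (S ∩ (C ∖ x))) ≤⟨ s≤s (size-∩∩-disjoint S B (C ∖ x) B∩C∖x-empty) ⟩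
      suc (size S)                         ≡⟨ cong suc |S| ⟩
      suc γ[ A ]                           ∎
      where
      open ≤-Reasoning
      open Glued g
      domB : DomSetOf G B (S ∩ B)
      domB = Glued-restrict g S-dom (inj₂ (u , u∈S , u∈B , a))
      S⊆A∖x : S ⊆ A ∖ x
      S⊆A∖x v v∈S = ∈-∖⁺ A v x (S⊆A v v∈S) (λ { refl → x∉S v∈S })
      domC : DomSetOf G (C ∖ x) (S ∩ (C ∖ x))
      domC = Split-restrict (Split-sym (Glued-split g)) (S⊆A∖x , λ v p → S-dom′ v (∖-⊆ A x v p))
      B∩C∖x-empty : ∀ v → v ∈ B → v ∈ C ∖ x → ⊥
      B∩C∖x-empty v v∈B v∈C∖x = ∈-∖-≢ C v x v∈C∖x (meet v v∈B (∖-⊆ C x v v∈C∖x))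

  -- Lower bound: a dominating set of A yields dominating sets of B and C
  -- that overlap at most in x.
  Γ-glued-≥ : ∀ {A B C x} → Glued A B C x → γ[ B ] + γ[ C ] ≤ suc γ[ A ]
  Γ-glued-≥ {A} {B} {C} {x} g with Γ-attained G A
  ... | S , S-dom , |S| with x ∈? S
  ... | yes x∈S = begin
    γ[ B ] + γ[ C ]               ≤⟨ +-mono-≤ (Γ-≤ G B _ (Glued-restrict g S-dom (inj₁ x∈S)))
                                              (Γ-≤ G C _ (Glued-restrict (Glued-sym g) S-dom (inj₁ x∈S))) ⟩
    size (S ∩ B) + size (S ∩ C)   ≤⟨ size-∩∩ S B C ⁅ x ⁆ B∩C⊆x ⟩
    size S + size ⁅ x ⁆           ≡⟨ cong₂ _+_ |S| (size-⁅⁆ x) ⟩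
    γ[ A ] + 1                    ≡⟨ +-comm _ 1 ⟩
    suc γ[ A ]                    ∎
    where
    open ≤-Reasoning
    B∩C⊆x : ∀ v → v ∈ B → v ∈ C → v ∈ ⁅ x ⁆
    B∩C⊆x v v∈B v∈C = subst (_∈ ⁅ x ⁆) (sym (Glued.meet g v v∈B v∈C)) (∈-⁅⁆ x)
  ... | no x∉S with proj₂ S-dom x (Glued.C⊆A g x (Glued.x∈C g))
  ...   | inj₁ x∈S = ⊥-elim (x∉S x∈S)
  ...   | inj₂ (u , u∈S , a) with Glued.cover g u (proj₁ S-dom u u∈S)
  ...     | inj₁ u∈B = Γ-glued-≥-via g S-dom |S| x∉S u∈S u∈B a
  ...     | inj₂ u∈C = subst (_≤ suc γ[ A ]) (+-comm γ[ C ] γ[ B ])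
                         (Γ-glued-≥-via (Glued-sym g) S-dom |S| x∉S u∈S u∈C a)

no-double-drop : ∀ b b′ c c′ d → b′ + c < d → b + c′ < d → d ≤ suc (b′ + c′) → d ≤ b + c → ⊥
no-double-drop b b′ c c′ d drop₁ drop₂ bound₁ bound₂ = <-irrefl refl (begin
  suc (suc ((b′ + c′) + (b + c)))  ≡⟨ rearrange ⟩
  suc (b′ + c) + suc (b + c′)      ≤⟨ +-mono-≤ drop₁ drop₂ ⟩
  d + d                            ≤⟨ +-mono-≤ bound₁ bound₂ ⟩
  suc ((b′ + c′) + (b + c))        ∎)
  where
  open ≤-Reasoning
  open +-*-Solver
  rearrange : suc (suc ((b′ + c′) + (b + c))) ≡ suc (b′ + c) + suc (b + c′)
  rearrange = solve 4 (λ b b′ c c′ → con 2 :+ ((b′ :+ c′) :+ (b :+ c))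
                                  := (con 1 :+ (b′ :+ c)) :+ (con 1 :+ (b :+ c′)))
                      refl b b′ c c′

critical? : ∀ {n} (G : Graph n) A v → Dec (v ∈ A → Γ G (A ∖ v) < Γ G A)
critical? G A v = (v ∈? A) →-dec (Γ G (A ∖ v) <? Γ G A)

critical-or-V⁰ : ∀ {n} (G : Graph n) A → (∀ v → v ∈ A → ¬ Γ G A < Γ G (A ∖ v)) →
                 CriticalIn G A ⊎ ∃ λ v → v ∈ A × Γ G (A ∖ v) ≡ Γ G A
critical-or-V⁰ {n} G A no-V⁺ with all? (critical? G A)
... | yes critical = inj₁ critical
... | no ¬critical with ¬∀⟶∃¬ n _ (critical? G A) ¬critical
...   | v , ¬drop with v ∈? A
...     | no  v∉A = ⊥-elim (¬drop (⊥-elim ∘ v∉A))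
...     | yes v∈A = inj₂ (v , v∈A , ≤-antisym (≮⇒≥ (no-V⁺ v v∈A)) (≮⇒≥ (¬drop ∘ λ drop _ → drop)))

module Gluing {n} (G : Graph n) where
  open Inequalities G

  Γ-glued-∖-≤ : ∀ {A B C x w} → Glued A B C x → w ∈ B → γ[ A ∖ w ] ≤ γ[ B ∖ w ] + γ[ C ∖ x ]
  Γ-glued-∖-≤ {x = x} {w} g w∈B with toSum (w ≟ x)
  ... | inj₁ refl = Γ-split-≤ (Glued-split g)
  ... | inj₂ w≢x  = Γ-glued-≤ (Glued-∖ w g w∈B w≢x)

  Γ-glued-∖-≥ : ∀ {A B C x w} → Glued A B C x → w ∈ B → γ[ B ∖ w ] + γ[ C ] ≤ suc γ[ A ∖ w ]
  Γ-glued-∖-≥ {A} {B} {C} {x} {w} g w∈B with toSum (w ≟ x)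
  ... | inj₂ w≢x  = Γ-glued-≥ (Glued-∖ w g w∈B w≢x)
  ... | inj₁ refl = begin
    γ[ B ∖ x ] + γ[ C ]             ≤⟨ +-monoʳ-≤ γ[ B ∖ x ] (Γ-∖ C x (Glued.x∈C g)) ⟩
    γ[ B ∖ x ] + suc γ[ C ∖ x ]     ≡⟨ +-suc _ _ ⟩
    suc (γ[ B ∖ x ] + γ[ C ∖ x ])   ≤⟨ s≤s (Γ-split-≥ (Glued-split g)) ⟩
    suc γ[ A ∖ x ]                  ∎
    where open ≤-Reasoning

  glued-sum : ∀ {A B C x} → Glued A B C x → γ[ C ∖ x ] < γ[ C ] → suc γ[ A ] ≡ γ[ B ] + γ[ C ]
  glued-sum {A} {B} {C} {x} g x-critical = ≤-antisym (begin
    suc γ[ A ]                 ≤⟨ s≤s (Γ-glued-≤ g) ⟩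
    suc (γ[ B ] + γ[ C ∖ x ])  ≡⟨ +-suc _ _ ⟨
    γ[ B ] + suc γ[ C ∖ x ]    ≤⟨ +-monoʳ-≤ γ[ B ] x-critical ⟩
    γ[ B ] + γ[ C ]            ∎) (Γ-glued-≥ g)
    where open ≤-Reasoning

  glued-critical : ∀ {A B C x} → Glued A B C x → γ[ C ∖ x ] < γ[ C ] →
                   ∀ w → w ∈ B → γ[ B ∖ w ] < γ[ B ] → γ[ A ∖ w ] < γ[ A ]
  glued-critical {A} {B} {C} {x} g x-critical w w∈B w-critical = ≤-pred (begin
    suc (suc γ[ A ∖ w ])              ≤⟨ s≤s (s≤s (Γ-glued-∖-≤ g w∈B)) ⟩
    suc (suc (γ[ B ∖ w ] + γ[ C ∖ x ])) ≡⟨ cong suc (+-suc _ _) ⟨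
    suc γ[ B ∖ w ] + suc γ[ C ∖ x ]   ≤⟨ +-mono-≤ w-critical x-critical ⟩
    γ[ B ] + γ[ C ]                   ≤⟨ Γ-glued-≥ g ⟩
    suc γ[ A ]                        ∎)
    where open ≤-Reasoning

  critical-glue : ∀ {A B C x} → Glued A B C x → CriticalIn G B → CriticalIn G C → CriticalIn G A
  critical-glue g B-critical C-critical w w∈A with Glued.cover g w w∈A
  ... | inj₁ w∈B = glued-critical g (C-critical _ (Glued.x∈C g)) w w∈B (B-critical w w∈B)
  ... | inj₂ w∈C = glued-critical (Glued-sym g) (B-critical _ (Glued.x∈B g)) w w∈C (C-critical w w∈C)

  critical-part : ∀ {A B C x} → Glued A B C x → CriticalIn G A → suc γ[ A ] ≡ γ[ B ] + γ[ C ] → CriticalIn G B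
  critical-part {A} {B} {C} {x} g A-critical sum w w∈B = +-cancelʳ-≤ γ[ C ] (suc γ[ B ∖ w ]) γ[ B ] (begin
    suc γ[ B ∖ w ] + γ[ C ]   ≤⟨ s≤s (Γ-glued-∖-≥ g w∈B) ⟩
    suc (suc γ[ A ∖ w ])      ≤⟨ s≤s (A-critical w (Glued.B⊆A g w w∈B)) ⟩
    suc γ[ A ]                ≡⟨ sum ⟩
    γ[ B ] + γ[ C ]           ∎)
    where open ≤-Reasoning

  weakBicritical-glue : ∀ {A B C x} → Glued A B C x → CriticalIn G B → WeakBicriticalIn G C →
                        γ[ C ∖ x ] < γ[ C ] → WeakBicriticalIn G A
  weakBicritical-glue {A} {B} {C} {x} g B-critical (no-C⁺ , C⁰-critical) x-critical = no-A⁺ , A⁰-critical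
    where
    open Glued g
    -- γ(B) = γ(B − x) + 1 and γ(A) + 1 = γ(B) + γ(C), hence:
    sum′ : γ[ B ∖ x ] + γ[ C ] ≡ γ[ A ]
    sum′ = suc-injective (trans (cong (_+ γ[ C ]) (≤-antisym (B-critical x x∈B) (Γ-∖ B x x∈B)))
                                (sym (glued-sum g x-critical)))
    bound : ∀ v → v ∈ C ∖ x → γ[ A ∖ v ] + γ[ C ] ≤ γ[ C ∖ v ] + γ[ A ]
    bound v v∈C∖x = begin
      γ[ A ∖ v ] + γ[ C ]               ≤⟨ +-monoˡ-≤ γ[ C ] (Γ-glued-≤ (Glued-sym (Glued-∖ʳ v g v∈C v≢x))) ⟩
      (γ[ C ∖ v ] + γ[ B ∖ x ]) + γ[ C ] ≡⟨ +-assoc γ[ C ∖ v ] _ _ ⟩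
      γ[ C ∖ v ] + (γ[ B ∖ x ] + γ[ C ]) ≡⟨ cong (γ[ C ∖ v ] +_) sum′ ⟩
      γ[ C ∖ v ] + γ[ A ]               ∎
      where
      open ≤-Reasoning
      v∈C : v ∈ C
      v∈C = ∖-⊆ C x v v∈C∖x
      v≢x : ¬ v ≡ x
      v≢x = ∈-∖-≢ C v x v∈C∖x
    no-A⁺ : ∀ v → v ∈ A → ¬ γ[ A ] < γ[ A ∖ v ]
    no-A⁺ v v∈A with Glued-cover g v v∈A
    ... | inj₁ v∈B   = <-asym (glued-critical g x-critical v v∈B (B-critical v v∈B))
    ... | inj₂ v∈C∖x = ≤⇒≯ (+-cancelʳ-≤ γ[ C ] _ _ (begin
      γ[ A ∖ v ] + γ[ C ]  ≤⟨ bound v v∈C∖x ⟩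
      γ[ C ∖ v ] + γ[ A ]  ≤⟨ +-monoˡ-≤ γ[ A ] (≮⇒≥ (no-C⁺ v (∖-⊆ C x v v∈C∖x))) ⟩
      γ[ C ] + γ[ A ]      ≡⟨ +-comm γ[ C ] _ ⟩
      γ[ A ] + γ[ C ]      ∎))
      where open ≤-Reasoning
    A⁰-critical : ∀ v → v ∈ A → γ[ A ∖ v ] ≡ γ[ A ] → CriticalIn G (A ∖ v)
    A⁰-critical v v∈A A⁰ with Glued-cover g v v∈A
    ... | inj₁ v∈B   = ⊥-elim (<-irrefl A⁰ (glued-critical g x-critical v v∈B (B-critical v v∈B)))
    ... | inj₂ v∈C∖x = critical-glue (Glued-∖ʳ v g v∈C v≢x) B-critical (C⁰-critical v v∈C C⁰)
      where
      v∈C : v ∈ C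
      v∈C = ∖-⊆ C x v v∈C∖x
      v≢x : ¬ v ≡ x
      v≢x = ∈-∖-≢ C v x v∈C∖x
      C⁰ : γ[ C ∖ v ] ≡ γ[ C ]
      C⁰ = ≤-antisym (≮⇒≥ (no-C⁺ v v∈C)) (+-cancelˡ-≤ γ[ A ] _ _ (begin
        γ[ A ] + γ[ C ]       ≡⟨ cong (_+ γ[ C ]) A⁰ ⟨
        γ[ A ∖ v ] + γ[ C ]   ≤⟨ bound v v∈C∖x ⟩
        γ[ C ∖ v ] + γ[ A ]   ≡⟨ +-comm γ[ C ∖ v ] _ ⟩
        γ[ A ] + γ[ C ∖ v ]   ∎))
        where open ≤-Reasoning

  weakBicritical-part : ∀ {A B C x} → Glued A B C x → WeakBicriticalIn G A → suc γ[ A ] ≡ γ[ B ] + γ[ C ] →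
                        γ[ B ∖ x ] < γ[ B ] →
                        WeakBicriticalIn G B × (∀ v → v ∈ B → γ[ B ∖ v ] ≡ γ[ B ] → CriticalIn G C)
  weakBicritical-part {A} {B} {C} {x} g (no-A⁺ , A⁰-critical) sum x-critical =
    (no-B⁺ , λ v v∈B B⁰ → proj₁ (V⁰-critical v v∈B B⁰)) , (λ v v∈B B⁰ → proj₂ (V⁰-critical v v∈B B⁰))
    where
    open Glued g
    no-B⁺ : ∀ v → v ∈ B → ¬ γ[ B ] < γ[ B ∖ v ]
    no-B⁺ v v∈B = ≤⇒≯ (+-cancelʳ-≤ γ[ C ] _ _ (begin
      γ[ B ∖ v ] + γ[ C ]  ≤⟨ Γ-glued-∖-≥ g v∈B ⟩
      suc γ[ A ∖ v ]       ≤⟨ s≤s (≮⇒≥ (no-A⁺ v (B⊆A v v∈B))) ⟩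
      suc γ[ A ]           ≡⟨ sum ⟩
      γ[ B ] + γ[ C ]      ∎))
      where open ≤-Reasoning
    V⁰-critical : ∀ v → v ∈ B → γ[ B ∖ v ] ≡ γ[ B ] → CriticalIn G (B ∖ v) × CriticalIn G C
    V⁰-critical v v∈B B⁰ = critical-part g′ A∖v-critical sum′ , critical-part (Glued-sym g′) A∖v-critical sum″
      where
      v≢x : ¬ v ≡ x
      v≢x refl = <-irrefl B⁰ x-critical
      g′ : Glued (A ∖ v) (B ∖ v) C x
      g′ = Glued-∖ v g v∈B v≢x
      A⁰ : γ[ A ∖ v ] ≡ γ[ A ]
      A⁰ = ≤-antisym (≮⇒≥ (no-A⁺ v (B⊆A v v∈B)))
             (≤-pred (subst (_≤ suc γ[ A ∖ v ]) (trans (cong (_+ γ[ C ]) B⁰) (sym sum)) (Γ-glued-∖-≥ g v∈B)))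
      A∖v-critical : CriticalIn G (A ∖ v)
      A∖v-critical = A⁰-critical v (B⊆A v v∈B) A⁰
      sum′ : suc γ[ A ∖ v ] ≡ γ[ B ∖ v ] + γ[ C ]
      sum′ = trans (cong suc A⁰) (trans sum (cong (_+ γ[ C ]) (sym B⁰)))
      sum″ : suc γ[ A ∖ v ] ≡ γ[ C ] + γ[ B ∖ v ]
      sum″ = trans sum′ (+-comm γ[ B ∖ v ] _)

  NeighbourIn : VSet n → Fin n → Set
  NeighbourIn B x = ∃ λ u → u ∈ B × adj G x u ≡ true

  neighbour-≢ : ∀ {x u} → adj G x u ≡ true → ¬ u ≡ x
  neighbour-≢ {x} x~u refl = contradictory x~u (Graph.irrefl G x)

  -- If x has neighbours u₁ ∈ B and u₂ ∈ C, then x ∉ V⁰(A) whenever A − x is critical: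
  -- deleting u₁ or u₂ from the split A − x lowers Γ, while x, u₁, u₂ lie in N[x].
  gluing-vertex-not-V⁰ : ∀ {A B C x} → Glued A B C x → NeighbourIn B x → NeighbourIn C x →
                         γ[ A ∖ x ] ≡ γ[ A ] → CriticalIn G (A ∖ x) → ⊥
  gluing-vertex-not-V⁰ {A} {B} {C} {x} g (u₁ , u₁∈B , x~u₁) (u₂ , u₂∈C , x~u₂) A⁰ A∖x-critical =
    no-double-drop γ[ B ∖ x ] γ[ B′ ] γ[ C ∖ x ] γ[ C′ ] γ[ A ∖ x ] drop₁ drop₂ bound (Γ-split-≤ s)
    where
    open Glued g
    s : Split (A ∖ x) (B ∖ x) (C ∖ x)
    s = Glued-split g
    u₁∈B∖x : u₁ ∈ B ∖ x
    u₁∈B∖x = ∈-∖⁺ B u₁ x u₁∈B (neighbour-≢ x~u₁)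
    u₂∈C∖x : u₂ ∈ C ∖ x
    u₂∈C∖x = ∈-∖⁺ C u₂ x u₂∈C (neighbour-≢ x~u₂)
    B′ C′ : VSet n
    B′ = B ∖ x ∖ u₁
    C′ = C ∖ x ∖ u₂
    drop₁ : γ[ B′ ] + γ[ C ∖ x ] < γ[ A ∖ x ]
    drop₁ = ≤-<-trans (Γ-split-≥ (Split-∖ u₁ s u₁∈B∖x)) (A∖x-critical u₁ (Split.B⊆A s u₁ u₁∈B∖x))
    drop₂ : γ[ B ∖ x ] + γ[ C′ ] < γ[ A ∖ x ]
    drop₂ = ≤-<-trans (≤-reflexive (+-comm γ[ B ∖ x ] _))
              (≤-<-trans (Γ-split-≥ (Split-∖ u₂ (Split-sym s) u₂∈C∖x)) (A∖x-critical u₂ (Split.C⊆A s u₂ u₂∈C∖x)))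
    in-B′∪C′ : ∀ w → w ∈ A → ¬ w ≡ x → ¬ w ≡ u₁ → ¬ w ≡ u₂ → w ∈ B′ ∪ C′
    in-B′∪C′ w w∈A w≢x w≢u₁ w≢u₂ with cover w w∈A
    ... | inj₁ w∈B = ∨-trueˡ _ (∈-∖⁺ (B ∖ x) w u₁ (∈-∖⁺ B w x w∈B w≢x) w≢u₁)
    ... | inj₂ w∈C = ∨-trueʳ (B′ w) (∈-∖⁺ (C ∖ x) w u₂ (∈-∖⁺ C w x w∈C w≢x) w≢u₂)
    near-x : ∀ w → w ∈ A → ¬ w ∈ B′ ∪ C′ → w ≡ x ⊎ adj G x w ≡ true
    near-x w w∈A w∉ with toSum (w ≟ x) | toSum (w ≟ u₁) | toSum (w ≟ u₂)
    ... | inj₁ w≡x | _         | _         = inj₁ w≡x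
    ... | inj₂ _   | inj₁ refl | _         = inj₂ x~u₁
    ... | inj₂ _   | inj₂ _    | inj₁ refl = inj₂ x~u₂
    ... | inj₂ w≢x | inj₂ w≢u₁ | inj₂ w≢u₂ = ⊥-elim (w∉ (in-B′∪C′ w w∈A w≢x w≢u₁ w≢u₂))
    B′∪C′⊆A : B′ ∪ C′ ⊆ A
    B′∪C′⊆A w p with ∨-true {B′ w} p
    ... | inj₁ w∈B′ = B⊆A w (∖-⊆ B x w (∖-⊆ (B ∖ x) u₁ w w∈B′))
    ... | inj₂ w∈C′ = C⊆A w (∖-⊆ C x w (∖-⊆ (C ∖ x) u₂ w w∈C′))
    bound : γ[ A ∖ x ] ≤ suc (γ[ B′ ] + γ[ C′ ])
    bound = begin
      γ[ A ∖ x ]               ≡⟨ A⁰ ⟩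
      γ[ A ]                   ≤⟨ Γ-star A (B′ ∪ C′) x (B⊆A x x∈B) B′∪C′⊆A near-x ⟩
      suc γ[ B′ ∪ C′ ]         ≤⟨ s≤s (Γ-cover (B′ ∪ C′) B′ C′ (λ w → ∨-trueˡ _) (λ w → ∨-trueʳ (B′ w))
                                                   (λ w → ∨-true)) ⟩
      suc (γ[ B′ ] + γ[ C′ ])  ∎
      where open ≤-Reasoning

  gluing-vertex-critical : ∀ {A B C x} → Glued A B C x → NeighbourIn B x → NeighbourIn C x →
                           WeakBicriticalIn G A → γ[ A ∖ x ] < γ[ A ]
  gluing-vertex-critical {A} {B} {C} {x} g nB nC (no-A⁺ , A⁰-critical) = by-trichotomy (<-cmp γ[ A ∖ x ] γ[ A ])
    where
    x∈A : x ∈ A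
    x∈A = Glued.B⊆A g x (Glued.x∈B g)
    by-trichotomy : Tri (γ[ A ∖ x ] < γ[ A ]) (γ[ A ∖ x ] ≡ γ[ A ]) (γ[ A ] < γ[ A ∖ x ]) → γ[ A ∖ x ] < γ[ A ]
    by-trichotomy (tri< drop _ _) = drop
    by-trichotomy (tri≈ _ A⁰ _)   = ⊥-elim (gluing-vertex-not-V⁰ g nB nC A⁰ (A⁰-critical x x∈A A⁰))
    by-trichotomy (tri> _ _ rise) = ⊥-elim (no-A⁺ x x∈A rise)

  -- ... and then in both parts: γ(B − x) + γ(C − x) ≤ γ(A − x) < γ(A) ≤ γ(B) + γ(C − x).
  gluing-vertex-critical-in-part : ∀ {A B C x} → Glued A B C x → γ[ A ∖ x ] < γ[ A ] → γ[ B ∖ x ] < γ[ B ]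
  gluing-vertex-critical-in-part {A} {B} {C} {x} g x-critical = +-cancelʳ-≤ γ[ C ∖ x ] _ _ (begin
    suc (γ[ B ∖ x ] + γ[ C ∖ x ]) ≤⟨ s≤s (Γ-split-≥ (Glued-split g)) ⟩
    suc γ[ A ∖ x ]                ≤⟨ x-critical ⟩
    γ[ A ]                        ≤⟨ Γ-glued-≤ g ⟩
    γ[ B ] + γ[ C ∖ x ]           ∎)
    where open ≤-Reasoning

  weakBicritical-split : ∀ {A B C x} → Glued A B C x → NeighbourIn B x → NeighbourIn C x → WeakBicriticalIn G A →
    suc γ[ A ] ≡ γ[ B ] + γ[ C ] ×
    ((CriticalIn G B × WeakBicriticalIn G C × γ[ C ∖ x ] < γ[ C ]) ⊎
     (CriticalIn G C × WeakBicriticalIn G B × γ[ B ∖ x ] < γ[ B ]))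
  weakBicritical-split {A} {B} {C} {x} g nB nC A-wb = sum , cases
    where
    x-critical : γ[ A ∖ x ] < γ[ A ]
    x-critical = gluing-vertex-critical g nB nC A-wb
    x-critical-in-B : γ[ B ∖ x ] < γ[ B ]
    x-critical-in-B = gluing-vertex-critical-in-part g x-critical
    x-critical-in-C : γ[ C ∖ x ] < γ[ C ]
    x-critical-in-C = gluing-vertex-critical-in-part (Glued-sym g) x-critical
    sum : suc γ[ A ] ≡ γ[ B ] + γ[ C ]
    sum = glued-sum g x-critical-in-C
    B-part : WeakBicriticalIn G B × (∀ v → v ∈ B → γ[ B ∖ v ] ≡ γ[ B ] → CriticalIn G C)
    B-part = weakBicritical-part g A-wb sum x-critical-in-B
    C-weakBicritical : WeakBicriticalIn G C
    C-weakBicritical = proj₁ (weakBicritical-part (Glued-sym g) A-wb (trans sum (+-comm γ[ B ] _)) x-critical-in-C)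
    -- Either B is critical, or a V⁰-vertex of B forces C to be critical.
    cases : (CriticalIn G B × WeakBicriticalIn G C × γ[ C ∖ x ] < γ[ C ]) ⊎
            (CriticalIn G C × WeakBicriticalIn G B × γ[ B ∖ x ] < γ[ B ])
    cases with critical-or-V⁰ G B (proj₁ (proj₁ B-part))
    ... | inj₁ B-critical     = inj₁ (B-critical , C-weakBicritical , x-critical-in-C)
    ... | inj₂ (v , v∈B , B⁰) = inj₂ (proj₂ B-part v v∈B B⁰ , proj₁ B-part , x-critical-in-B)

module GluedGraph {a b : ℕ} (H₁ : Graph (suc a)) (H₂ : Graph (suc b))
                  (x₁ : Fin (suc a)) (x₂ : Fin (suc b)) where
  open Glue H₁ H₂ x₁ x₂

  G : Graph (suc a + b)
  G = glue H₁ H₂ x₁ x₂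

  left : Fin (suc a) → Fin (suc a + b)
  left p = p ↑ˡ b

  right : Fin b → Fin (suc a + b)
  right r = suc a ↑ʳ r

  origin-left : ∀ p → origin (left p) ≡ inj₁ p
  origin-left p rewrite splitAt-↑ˡ (suc a) p b = refl

  origin-right : ∀ r → origin (right r) ≡ inj₂ (punchIn x₂ r)
  origin-right r rewrite splitAt-↑ʳ (suc a) b r = refl

  side : ∀ v → (∃ λ p → left p ≡ v) ⊎ (∃ λ r → right r ≡ v)
  side v with splitAt (suc a) v in eq
  ... | inj₁ p = inj₁ (p , splitAt⁻¹-↑ˡ eq)
  ... | inj₂ r = inj₂ (r , splitAt⁻¹-↑ʳ eq)

  x : Fin (suc a + b)
  x = left x₁

  isLeft : Fin (suc a) ⊎ Fin b → Bool
  isLeft (inj₁ _) = true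
  isLeft (inj₂ _) = false

  V₁ V₂ : VSet (suc a + b)
  V₁ v = isLeft (splitAt (suc a) v)
  V₂ v = not (V₁ v) ∨ does (v ≟ x)

  left∈V₁ : ∀ p → left p ∈ V₁
  left∈V₁ p rewrite splitAt-↑ˡ (suc a) p b = refl

  right∉V₁ : ∀ r → V₁ (right r) ≡ false
  right∉V₁ r rewrite splitAt-↑ʳ (suc a) b r = refl

  right∈V₂ : ∀ r → right r ∈ V₂
  right∈V₂ r rewrite right∉V₁ r = refl

  x∈V₂ : x ∈ V₂
  x∈V₂ = ∨-trueʳ (not (V₁ x)) (∈-⁅⁆ x)

  left≢right : ∀ p r → ¬ left p ≡ right r
  left≢right p r e = contradictory (trans (cong V₁ (sym e)) (left∈V₁ p)) (right∉V₁ r)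

  cross-x₁ : ∀ q → cross x₁ q ≡ adj H₂ x₂ q
  cross-x₁ q rewrite dec-true (x₁ ≟ x₁) refl = refl

  cross-other : ∀ p q → ¬ p ≡ x₁ → cross p q ≡ false
  cross-other p q p≢x₁ rewrite dec-false (p ≟ x₁) p≢x₁ = refl

  embed₁ : Embedding H₁ G V₁
  embed₁ = record
    { embed     = left
    ; injective = λ {i} {j} → ↑ˡ-injective b i j
    ; adjacency = λ i j → sym (cong₂ adjO (origin-left i) (origin-left j))
    ; into      = left∈V₁
    ; onto      = onto }
    where
    onto : ∀ v → v ∈ V₁ → ∃ λ i → left i ≡ v
    onto v v∈V₁ with side v
    ... | inj₁ p-left       = p-left
    ... | inj₂ (r , refl) = ⊥-elim (contradictory v∈V₁ (right∉V₁ r))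

  embed₂-map : Fin (suc b) → Fin (suc a + b)
  embed₂-map q with q ≟ x₂
  ... | yes _   = x
  ... | no q≢x₂ = right (punchOut (λ e → q≢x₂ (sym e)))

  embed₂-cases : ∀ q → (q ≡ x₂ × embed₂-map q ≡ x) ⊎ (∃ λ r → q ≡ punchIn x₂ r × embed₂-map q ≡ right r)
  embed₂-cases q with q ≟ x₂
  ... | yes q≡x₂ = inj₁ (q≡x₂ , refl)
  ... | no q≢x₂  = inj₂ (_ , sym (punchIn-punchOut (λ e → q≢x₂ (sym e))) , refl)

  embed₂-x₂ : embed₂-map x₂ ≡ x
  embed₂-x₂ with embed₂-cases x₂
  ... | inj₁ (_ , e)     = e
  ... | inj₂ (r , e , _) = ⊥-elim (punchInᵢ≢i x₂ r (sym e))

  embed₂-punchIn : ∀ r → embed₂-map (punchIn x₂ r) ≡ right r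
  embed₂-punchIn r with embed₂-cases (punchIn x₂ r)
  ... | inj₁ (e , _)      = ⊥-elim (punchInᵢ≢i x₂ r e)
  ... | inj₂ (r′ , e , e′) = trans e′ (cong right (sym (punchIn-injective x₂ r r′ e)))

  embed₂ : Embedding H₂ G V₂
  embed₂ = record
    { embed = embed₂-map ; injective = injective ; adjacency = adjacency ; into = into ; onto = onto }
    where
    injective : ∀ {q q′} → embed₂-map q ≡ embed₂-map q′ → q ≡ q′
    injective {q} {q′} e with embed₂-cases q | embed₂-cases q′
    ... | inj₁ (q≡x₂ , _)   | inj₁ (q′≡x₂ , _)     = trans q≡x₂ (sym q′≡x₂)
    ... | inj₁ (_ , ex)     | inj₂ (r , _ , er)    = ⊥-elim (left≢right x₁ r (trans (sym ex) (trans e er)))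
    ... | inj₂ (r , _ , er) | inj₁ (_ , ex)        = ⊥-elim (left≢right x₁ r (trans (sym ex) (trans (sym e) er)))
    ... | inj₂ (r , q≡ , er) | inj₂ (r′ , q′≡ , er′) =
      trans q≡ (trans (cong (punchIn x₂) (↑ʳ-injective (suc a) r r′ (trans (sym er) (trans e er′))))
                      (sym q′≡))
    adjacency : ∀ q q′ → adj H₂ q q′ ≡ adj G (embed₂-map q) (embed₂-map q′)
    adjacency q q′ with embed₂-cases q | embed₂-cases q′
    ... | inj₁ (refl , e) | inj₁ (refl , e′) rewrite e | e′ | origin-left x₁ =
      trans (Graph.irrefl H₂ x₂) (sym (Graph.irrefl H₁ x₁))
    ... | inj₁ (refl , e) | inj₂ (r , refl , e′) rewrite e | e′ | origin-left x₁ | origin-right r =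
      sym (cross-x₁ (punchIn x₂ r))
    ... | inj₂ (r , refl , e) | inj₁ (refl , e′) rewrite e | e′ | origin-left x₁ | origin-right r =
      trans (Graph.sym H₂ _ _) (sym (cross-x₁ (punchIn x₂ r)))
    ... | inj₂ (r , refl , e) | inj₂ (r′ , refl , e′) rewrite e | e′ | origin-right r | origin-right r′ = refl
    into : ∀ q → embed₂-map q ∈ V₂
    into q with embed₂-cases q
    ... | inj₁ (_ , e)     rewrite e = x∈V₂
    ... | inj₂ (r , _ , e) rewrite e = right∈V₂ r
    onto : ∀ v → v ∈ V₂ → ∃ λ q → embed₂-map q ≡ v
    onto v v∈V₂ with side v
    ... | inj₂ (r , refl) = punchIn x₂ r , embed₂-punchIn r
    ... | inj₁ (p , refl) rewrite left∈V₁ p = x₂ , trans embed₂-x₂ (sym (∈-⁅⁆⁻ v∈V₂))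

  open Inequalities G

  decomposition : Glued full V₁ V₂ x
  decomposition = record
    { B⊆A = λ _ _ → refl ; C⊆A = λ _ _ → refl ; cover = cover
    ; x∈B = left∈V₁ x₁ ; x∈C = x∈V₂ ; meet = meet ; no-edge = no-edge }
    where
    cover : ∀ v → v ∈ full → v ∈ V₁ ⊎ v ∈ V₂
    cover v _ with V₁ v
    ... | true  = inj₁ refl
    ... | false = inj₂ refl
    meet : ∀ v → v ∈ V₁ → v ∈ V₂ → v ≡ x
    meet v v∈V₁ v∈V₂ rewrite v∈V₁ = ∈-⁅⁆⁻ v∈V₂
    no-edge : ∀ u w → u ∈ V₁ → w ∈ V₂ → ¬ u ≡ x → ¬ w ≡ x → adj G u w ≡ false
    no-edge u w u∈V₁ w∈V₂ u≢x w≢x with side u | side w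
    ... | inj₂ (r , refl) | _ = ⊥-elim (contradictory u∈V₁ (right∉V₁ r))
    ... | inj₁ (p , refl) | inj₁ (p′ , refl) rewrite left∈V₁ p′ = ⊥-elim (w≢x (∈-⁅⁆⁻ w∈V₂))
    ... | inj₁ (p , refl) | inj₂ (r , refl) rewrite origin-left p | origin-right r =
      cross-other p _ (λ p≡x₁ → u≢x (cong left p≡x₁))

  open Gluing G

  neighbour₁ : NonIsolated H₁ x₁ → NeighbourIn V₁ x
  neighbour₁ (y , x₁~y) = left y , left∈V₁ y , trans (sym (Embedding.adjacency embed₁ x₁ y)) x₁~y

  neighbour₂ : NonIsolated H₂ x₂ → NeighbourIn V₂ x
  neighbour₂ (y , x₂~y) = embed₂-map y , Embedding.into embed₂ y ,
    subst (λ z → adj G z (embed₂-map y) ≡ true) embed₂-x₂ (trans (sym (Embedding.adjacency embed₂ x₂ y)) x₂~y)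

  whole : WeakBicritical G ⇔ WeakBicriticalIn G full
  whole = weakBicritical⇔ (identity G)

  x₁-critical : InV⁻ H₁ x₁ ⇔ γ[ V₁ ∖ x ] < γ[ V₁ ]
  x₁-critical = critical-vertex⇔ embed₁ x₁

  x₂-critical : InV⁻ H₂ x₂ ⇔ γ[ V₂ ∖ x ] < γ[ V₂ ]
  x₂-critical = subst (λ v → InV⁻ H₂ x₂ ⇔ γ[ V₂ ∖ v ] < γ[ V₂ ]) embed₂-x₂ (critical-vertex⇔ embed₂ x₂)

open Equivalence using (to; from)

theorem2p1 : ∀ {a b} (H₁ : Graph (suc a)) (H₂ : Graph (suc b))
    (x₁ : Fin (suc a)) (x₂ : Fin (suc b)) →
    NonIsolated H₁ x₁ → NonIsolated H₂ x₂ →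
    (WeakBicritical (glue H₁ H₂ x₁ x₂)
    ⇔ ((Critical H₁ × WeakBicritical H₂ × InV⁻ H₂ x₂)
    ⊎ (Critical H₂ × WeakBicritical H₁ × InV⁻ H₁ x₁)))
    × (WeakBicritical (glue H₁ H₂ x₁ x₂)
    → γ (glue H₁ H₂ x₁ x₂) ≡ γ H₁ + γ H₂ ∸ 1)
theorem2p1 H₁ H₂ x₁ x₂ non-isolated₁ non-isolated₂ = mk⇔ forth back , formula
  where
  open GluedGraph H₁ H₂ x₁ x₂
  open Gluing G
  open Inequalities G using (γ[_]; Glued-sym)

  decomposes : WeakBicritical G → suc γ[ full ] ≡ γ[ V₁ ] + γ[ V₂ ] ×
                 ((CriticalIn G V₁ × WeakBicriticalIn G V₂ × γ[ V₂ ∖ x ] < γ[ V₂ ]) ⊎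
                  (CriticalIn G V₂ × WeakBicriticalIn G V₁ × γ[ V₁ ∖ x ] < γ[ V₁ ]))
  decomposes wb =
    weakBicritical-split decomposition (neighbour₁ non-isolated₁) (neighbour₂ non-isolated₂) (to whole wb)

  forth : WeakBicritical G →
          (Critical H₁ × WeakBicritical H₂ × InV⁻ H₂ x₂) ⊎ (Critical H₂ × WeakBicritical H₁ × InV⁻ H₁ x₁)
  forth wb with proj₂ (decomposes wb)
  ... | inj₁ (c₁ , w₂ , d₂) =
    inj₁ (from (critical⇔ embed₁) c₁ , from (weakBicritical⇔ embed₂) w₂ , from x₂-critical d₂)
  ... | inj₂ (c₂ , w₁ , d₁) =
    inj₂ (from (critical⇔ embed₂) c₂ , from (weakBicritical⇔ embed₁) w₁ , from x₁-critical d₁)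

  back : (Critical H₁ × WeakBicritical H₂ × InV⁻ H₂ x₂) ⊎ (Critical H₂ × WeakBicritical H₁ × InV⁻ H₁ x₁) →
         WeakBicritical G
  back (inj₁ (c₁ , w₂ , d₂)) = from whole (weakBicritical-glue decomposition
    (to (critical⇔ embed₁) c₁) (to (weakBicritical⇔ embed₂) w₂) (to x₂-critical d₂))
  back (inj₂ (c₂ , w₁ , d₁)) = from whole (weakBicritical-glue (Glued-sym decomposition)
    (to (critical⇔ embed₂) c₂) (to (weakBicritical⇔ embed₁) w₁) (to x₁-critical d₁))

  formula : WeakBicritical G → γ G ≡ γ H₁ + γ H₂ ∸ 1
  formula wb = begin
    γ G                    ≡⟨ γ≡Γ-full G ⟩
    suc γ[ full ] ∸ 1      ≡⟨ cong (_∸ 1) (proj₁ (decomposes wb)) ⟩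
    γ[ V₁ ] + γ[ V₂ ] ∸ 1  ≡⟨ cong (_∸ 1) (cong₂ _+_ (γ-embedding embed₁) (γ-embedding embed₂)) ⟨
    γ H₁ + γ H₂ ∸ 1        ∎
    where open ≡-Reasoning
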